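{- For every integer $n\ge0$, the misère monoid $\mathcal{M}_{\mathrm{cl}(\mathsf{L}(\tau^{2n}))}$ has exactly two elements, namely the equivalence classes of $0$ and $*$.
   Context: A position $\xi=\{\xi^L \mid \xi^R\}$ is given recursively by finite sets of Left and Right options; $\cdot$ denotes an empty set. $0=\{\cdot\mid\cdot\}$, $*=\{0\mid0\}$, $\tau^0=*$, $\tau^k=\{\tau^{k-1}\mid\tau^{k-1}\}$ for $k\ge1$, and $\mathsf{L}(\xi)=\{\xi\mid\cdot\}$. Disjunctive sum: $\alpha+\beta=\{\alpha^L+\beta,\alpha+\beta^L \mid \alpha^R+\beta,\alpha+\beta^R\}$. Under misère play a player unable to move on their turn wins; $o^-$ denotes misère outcome ($\mathcal{L}$, $\mathcal{R}$, $\mathcal{N}$ next player wins, $\mathcal{P}$ next player loses). $\mathrm{cl}(\xi)$ is the smallest set containing $\xi$ closed under disjunctive sum and taking options. For closed $\Gamma$, $\alpha\equiv\beta\pmod\Gamma$ iff $o^-(\alpha+\gamma)=o^-(\beta+\gamma)$ for all $\gamma\in\Gamma$; the misère monoid $\mathcal{M}_\Gamma$ is the set of $\equiv$-classes with the monoid operation induced by disjunctive sum. -}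

module Defs where

open import Data.Nat using (ℕ; zero; suc; _*_)
open import Data.Bool using (Bool; true; false; not; _∨_)
open import Data.List using (List; []; _∷_; _++_)
open import Data.List.Membership.Propositional using (_∈_)
open import Data.Sum using (_⊎_)
open import Data.Product using (_×_)
open import Relation.Binary.PropositionalEquality using (_≡_)
open import Relation.Nullary using (¬_)

data Game : Set where
  ⟨_∣_⟩ : List Game → List Game → Game

leftOpts : Game → List Game
leftOpts ⟨ L ∣ R ⟩ = L

rightOpts : Game → List Game
rightOpts ⟨ L ∣ R ⟩ = R

𝟘 : Game
𝟘 = ⟨ [] ∣ [] ⟩

⋆ : Game
⋆ = ⟨ 𝟘 ∷ [] ∣ 𝟘 ∷ [] ⟩

τ : ℕ → Game
τ zero = ⋆
τ (suc k) = ⟨ τ k ∷ [] ∣ τ k ∷ [] ⟩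

𝕃 : Game → Game
𝕃 ξ = ⟨ ξ ∷ [] ∣ [] ⟩

infixl 6 _⊕_
mutual
  _⊕_ : Game → Game → Game
  a@(⟨ L ∣ R ⟩) ⊕ b@(⟨ L' ∣ R' ⟩) =
    ⟨ sumL L b ++ sumR a L' ∣ sumL R b ++ sumR a R' ⟩

  sumL : List Game → Game → List Game
  sumL [] b = []
  sumL (x ∷ xs) b = (x ⊕ b) ∷ sumL xs b

  sumR : Game → List Game → List Game
  sumR a [] = []
  sumR a (y ∷ ys) = (a ⊕ y) ∷ sumR a ys

-- Misère play: a player unable to move on their turn wins.
-- leftFirst g  : Left, moving first in g, wins.
-- rightFirst g : Right, moving first in g, wins.
mutual
  leftFirst : Game → Bool
  leftFirst ⟨ [] ∣ R ⟩ = true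
  leftFirst ⟨ x ∷ xs ∣ R ⟩ = someRightLoses (x ∷ xs)

  rightFirst : Game → Bool
  rightFirst ⟨ L ∣ [] ⟩ = true
  rightFirst ⟨ L ∣ y ∷ ys ⟩ = someLeftLoses (y ∷ ys)

  someRightLoses : List Game → Bool
  someRightLoses [] = false
  someRightLoses (x ∷ xs) = not (rightFirst x) ∨ someRightLoses xs

  someLeftLoses : List Game → Bool
  someLeftLoses [] = false
  someLeftLoses (y ∷ ys) = not (leftFirst y) ∨ someLeftLoses ys

data Outcome : Set where
  𝓛 𝓡 𝓝 𝓟 : Outcome

outcome : Bool → Bool → Outcome
outcome true  true  = 𝓝
outcome true  false = 𝓛
outcome false true  = 𝓡
outcome false false = 𝓟

o⁻ : Game → Outcome
o⁻ g = outcome (leftFirst g) (rightFirst g)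

data Cl (ξ : Game) : Game → Set where
  base : Cl ξ ξ
  sum  : ∀ {α β} → Cl ξ α → Cl ξ β → Cl ξ (α ⊕ β)
  optL : ∀ {α x} → Cl ξ α → x ∈ leftOpts α → Cl ξ x
  optR : ∀ {α x} → Cl ξ α → x ∈ rightOpts α → Cl ξ x

_≡[_]_ : Game → (Game → Set) → Game → Set
α ≡[ Γ ] β = ∀ γ → Γ γ → o⁻ (α ⊕ γ) ≡ o⁻ (β ⊕ γ)

-- The misère monoid of Γ has exactly two elements, the classes of 0 and *:
-- 0, * ∈ Γ, 0 ≢ * (mod Γ), and every element of Γ is equivalent to 0 or *.
MonoidIsZeroStar : (Game → Set) → Set
MonoidIsZeroStar Γ =
  Γ 𝟘 × Γ ⋆ × (¬ (𝟘 ≡[ Γ ] ⋆)) × (∀ α → Γ α → (α ≡[ Γ ] 𝟘) ⊎ (α ≡[ Γ ] ⋆))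

module Submission where

-- Call a position ξ *uniform of oddness o* when every option of ξ
-- is uniform of oddness (not o), and a player can be out of moves in ξ only if
-- o is false.  Inductively this says that whenever a player is stuck, an even
-- number of moves has been made (counting from oddness false), so under misère
-- play such a position behaves like 0 (o = false) or like * (o = true):
--   * uniform positions are closed under options (oddness flips) and under
--     disjunctive sum (oddnesses add as xor);
--   * a uniform position of oddness o has misère outcome 𝓝 if o is false and
--     𝓟 if o is true, whoever starts;
--   * hence, over any universe Γ of uniform positions, two positions of equal
--     oddness are equivalent modulo Γ.
-- Since 𝖫(τ^{2n}) is uniform of oddness false (τ^{2n} has oddness true),
-- everything in cl(𝖫(τ^{2n})) is uniform, so every element is equivalent to
-- 0 or to *; and 0 ≢ * because 0 + 0 is an 𝓝-position and * + 0 a 𝓟-position.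

open import Defs
open import Data.Nat using (ℕ; zero; suc; _*_)
open import Data.Nat.Properties using (*-suc)
open import Data.Bool using (Bool; true; false; not; _∨_; _xor_)
open import Data.Bool.Properties
  using (not-involutive; ∨-idem; ∨-identityʳ; not-distribˡ-xor; not-distribʳ-xor)
open import Data.List using (List; []; _∷_; _++_)
open import Data.List.Properties using (++-conicalˡ; ++-conicalʳ)
open import Data.List.Relation.Unary.All using (All; []; _∷_; lookup)
open import Data.List.Relation.Unary.Any using (here)
open import Data.List.Membership.Propositional using (_∈_)
open import Data.Product using (∃; _,_)
open import Relation.Nullary using (¬_)
open import Data.Sum using (_⊎_; inj₁; inj₂)
open import Relation.Binary.PropositionalEquality
  using (_≡_; refl; sym; trans; cong; cong₂; subst)
open Relation.Binary.PropositionalEquality.≡-Reasoning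

data Uniform : Bool → Game → Set where
  uniform : ∀ {o L R} →
            All (Uniform (not o)) L → All (Uniform (not o)) R →
            (L ≡ [] → o ≡ false) → (R ≡ [] → o ≡ false) →
            Uniform o ⟨ L ∣ R ⟩

recast : ∀ {o o′ g} → o ≡ o′ → Uniform o g → Uniform o′ g
recast = subst (λ o → Uniform o _)

uniform-optL : ∀ {o α x} → Uniform o α → x ∈ leftOpts α → Uniform (not o) x
uniform-optL (uniform aL _ _ _) x∈ = lookup aL x∈

uniform-optR : ∀ {o α x} → Uniform o α → x ∈ rightOpts α → Uniform (not o) x
uniform-optR (uniform _ aR _ _) x∈ = lookup aR x∈

sumL-empty : ∀ xs h → sumL xs h ≡ [] → xs ≡ []
sumL-empty []      h _ = refl
sumL-empty (_ ∷ _) h ()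

sumR-empty : ∀ g ys → sumR g ys ≡ [] → ys ≡ []
sumR-empty g []      _ = refl
sumR-empty g (_ ∷ _) ()

mutual
  uniform-sum : ∀ {o o′ g h} → Uniform o g → Uniform o′ h → Uniform (o xor o′) (g ⊕ h)
  uniform-sum {o} {o′} {⟨ L ∣ R ⟩} {⟨ L′ ∣ R′ ⟩}
              ug@(uniform aL aR eL eR) uh@(uniform aL′ aR′ eL′ eR′) =
    uniform (all-++ (uniform-sumL aL uh) (uniform-sumR ug aL′))
            (all-++ (uniform-sumL aR uh) (uniform-sumR ug aR′))
            (stuck eL eL′) (stuck eR eR′)
    where
    all-++ : ∀ {P : Game → Set} {xs ys} → All P xs → All P ys → All P (xs ++ ys)
    all-++ []       q = q
    all-++ (p ∷ ps) q = p ∷ all-++ ps q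

    -- a player is stuck in g ⊕ h only if stuck in both summands
    stuck : ∀ {xs ys} → (xs ≡ [] → o ≡ false) → (ys ≡ [] → o′ ≡ false) →
            sumL xs (⟨ L′ ∣ R′ ⟩) ++ sumR (⟨ L ∣ R ⟩) ys ≡ [] → o xor o′ ≡ false
    stuck {xs} {ys} ex ey e
      with ex (sumL-empty xs _ (++-conicalˡ _ _ e))
         | ey (sumR-empty _ ys (++-conicalʳ _ _ e))
    ... | refl | refl = refl

  uniform-sumL : ∀ {o o′ xs h} → All (Uniform (not o)) xs → Uniform o′ h →
                 All (Uniform (not (o xor o′))) (sumL xs h)
  uniform-sumL []                 uh = []
  uniform-sumL {o} {o′} (ux ∷ ua) uh =
    recast (sym (not-distribˡ-xor o o′)) (uniform-sum ux uh) ∷ uniform-sumL ua uh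

  uniform-sumR : ∀ {o o′ g ys} → Uniform o g → All (Uniform (not o′)) ys →
                 All (Uniform (not (o xor o′))) (sumR g ys)
  uniform-sumR ug []                 = []
  uniform-sumR {o} {o′} ug (uy ∷ ua) =
    recast (sym (not-distribʳ-xor o o′)) (uniform-sum ug uy) ∷ uniform-sumR ug ua

-- The value of a disjunction over a list whose entries all equal p.
orEmpty : Bool → List Game → Bool
orEmpty p []      = false
orEmpty p (_ ∷ _) = p

∨-orEmpty : ∀ p xs → p ∨ orEmpty p xs ≡ p
∨-orEmpty p []      = ∨-identityʳ p
∨-orEmpty p (_ ∷ _) = ∨-idem p

mutual
  leftFirst-uniform : ∀ {o g} → Uniform o g → leftFirst g ≡ not o
  leftFirst-uniform (uniform {L = []}    _  _ eL _) = cong not (sym (eL refl))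
  leftFirst-uniform (uniform {L = _ ∷ _} aL _ _  _) = someRightLoses-uniform aL

  rightFirst-uniform : ∀ {o g} → Uniform o g → rightFirst g ≡ not o
  rightFirst-uniform (uniform {R = []}    _ _  _ eR) = cong not (sym (eR refl))
  rightFirst-uniform (uniform {R = _ ∷ _} _ aR _ _)  = someLeftLoses-uniform aR

  someRightLoses-uniform : ∀ {p x xs} → All (Uniform p) (x ∷ xs) → someRightLoses (x ∷ xs) ≡ p
  someRightLoses-uniform {p} {x} {xs} (ux ∷ ua) = begin
    not (rightFirst x) ∨ someRightLoses xs ≡⟨ cong₂ _∨_ (reply-fails ux) (rest ua) ⟩
    p ∨ orEmpty p xs                        ≡⟨ ∨-orEmpty p xs ⟩
    p                                       ∎
    where
    reply-fails : Uniform p x → not (rightFirst x) ≡ p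
    reply-fails u = trans (cong not (rightFirst-uniform u)) (not-involutive p)
    rest : ∀ {ys} → All (Uniform p) ys → someRightLoses ys ≡ orEmpty p ys
    rest []      = refl
    rest (u ∷ a) = someRightLoses-uniform (u ∷ a)

  someLeftLoses-uniform : ∀ {p y ys} → All (Uniform p) (y ∷ ys) → someLeftLoses (y ∷ ys) ≡ p
  someLeftLoses-uniform {p} {y} {ys} (uy ∷ ua) = begin
    not (leftFirst y) ∨ someLeftLoses ys ≡⟨ cong₂ _∨_ (reply-fails uy) (rest ua) ⟩
    p ∨ orEmpty p ys                     ≡⟨ ∨-orEmpty p ys ⟩
    p                                    ∎
    where
    reply-fails : Uniform p y → not (leftFirst y) ≡ p
    reply-fails u = trans (cong not (leftFirst-uniform u)) (not-involutive p)
    rest : ∀ {zs} → All (Uniform p) zs → someLeftLoses zs ≡ orEmpty p zs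
    rest []      = refl
    rest (u ∷ a) = someLeftLoses-uniform (u ∷ a)

o⁻-uniform : ∀ {o g} → Uniform o g → o⁻ g ≡ outcome (not o) (not o)
o⁻-uniform u = cong₂ outcome (leftFirst-uniform u) (rightFirst-uniform u)

uniform-equivalent : ∀ {Γ : Game → Set} {o α β} →
                     (∀ γ → Γ γ → ∃ λ p → Uniform p γ) →
                     Uniform o α → Uniform o β → α ≡[ Γ ] β
uniform-equivalent uniformΓ uα uβ γ γ∈Γ with uniformΓ γ γ∈Γ
... | _ , uγ = trans (o⁻-uniform (uniform-sum uα uγ)) (sym (o⁻-uniform (uniform-sum uβ uγ)))

cl-uniform : ∀ {o ξ α} → Uniform o ξ → Cl ξ α → ∃ λ p → Uniform p α
cl-uniform uξ base = _ , uξ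
cl-uniform uξ (sum cα cβ) with cl-uniform uξ cα | cl-uniform uξ cβ
... | _ , uα | _ , uβ = _ , uniform-sum uα uβ
cl-uniform uξ (optL cα x∈) with cl-uniform uξ cα
... | _ , uα = _ , uniform-optL uα x∈
cl-uniform uξ (optR cα x∈) with cl-uniform uξ cα
... | _ , uα = _ , uniform-optR uα x∈

uniform-𝟘 : Uniform false 𝟘
uniform-𝟘 = uniform [] [] (λ _ → refl) (λ _ → refl)

uniform-⋆ : Uniform true ⋆
uniform-⋆ = uniform (uniform-𝟘 ∷ []) (uniform-𝟘 ∷ []) (λ ()) (λ ())

uniform-τ-suc : ∀ {o k} → Uniform o (τ k) → Uniform (not o) (τ (suc k))
uniform-τ-suc {o} {k} u = uniform (u′ ∷ []) (u′ ∷ []) (λ ()) (λ ())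
  where
  u′ : Uniform (not (not o)) (τ k)
  u′ = recast (sym (not-involutive o)) u

uniform-τ-even : ∀ n → Uniform true (τ (2 * n))
uniform-τ-even zero    = uniform-⋆
uniform-τ-even (suc n) =
  subst (λ k → Uniform true (τ k)) (sym (*-suc 2 n))
        (uniform-τ-suc {k = suc (2 * n)} (uniform-τ-suc (uniform-τ-even n)))

uniform-𝕃 : ∀ {ξ} → Uniform true ξ → Uniform false (𝕃 ξ)
uniform-𝕃 u = uniform (u ∷ []) [] (λ ()) (λ _ → refl)

-- * is reached from τ^k by k Left moves, so it lies in any closure containing τ^k.
cl-⋆ : ∀ {ξ} k → Cl ξ (τ k) → Cl ξ ⋆
cl-⋆ zero    c = c
cl-⋆ (suc k) c = cl-⋆ k (optL c (here refl))

theorem3p4p7 : (n : ℕ) → MonoidIsZeroStar (Cl (𝕃 (τ (2 * n))))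
theorem3p4p7 n = cl-𝟘 , cl-⋆′ , 𝟘≢⋆ , classify
  where
  ξ = 𝕃 (τ (2 * n))
  uniformΓ : ∀ γ → Cl ξ γ → ∃ λ p → Uniform p γ
  uniformΓ _ = cl-uniform (uniform-𝕃 (uniform-τ-even n))
  cl-⋆′ : Cl ξ ⋆
  cl-⋆′ = cl-⋆ (2 * n) (optL base (here refl))
  cl-𝟘 : Cl ξ 𝟘
  cl-𝟘 = optL cl-⋆′ (here refl)
  -- 0 + 0 is an 𝓝-position, * + 0 a 𝓟-position
  𝟘≢⋆ : ¬ (𝟘 ≡[ Cl ξ ] ⋆)
  𝟘≢⋆ eq with eq 𝟘 cl-𝟘
  ... | ()
  classify : ∀ α → Cl ξ α → (α ≡[ Cl ξ ] 𝟘) ⊎ (α ≡[ Cl ξ ] ⋆)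
  classify α cα with uniformΓ α cα
  ... | false , uα = inj₁ (uniform-equivalent uniformΓ uα uniform-𝟘)
  ... | true  , uα = inj₂ (uniform-equivalent uniformΓ uα uniform-⋆)
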